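{- For every integer $n\ge0$, $3\mid s(n)$ if and only if $n\in A_3$.
   Context: The Stern sequence $(s(n))_{n\ge0}$ is defined by $s(0)=0$, $s(1)=1$, $s(2n)=s(n)$, $s(2n+1)=s(n)+s(n+1)$. The set $A_3\subset\mathbb N$ is defined recursively as the smallest set such that $0,5,7\in A_3$, and whenever $0<n\in A_3$, also $2n,\ 8n+5,\ 8n-5,\ 8n+7,\ 8n-7\in A_3$. -}

module Defs where

open import Data.Nat using (ℕ; zero; suc; _<_; _+_; _*_; _∸_; ⌊_/2⌋)
open import Data.Bool using (Bool; true; false)

odd? : ℕ → Bool
odd? zero = false
odd? (suc zero) = true
odd? (suc (suc n)) = odd? n

-- Stern's diatomic sequence:
--   s(0)=0, s(1)=1, s(2n)=s(n), s(2n+1)=s(n)+s(n+1).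
-- Implemented with a fuel argument; sternF k n follows the recursion
-- faithfully whenever n ≤ k (recursive arguments of n+2 are ≤ n+1).
sternF : ℕ → ℕ → ℕ
sternF _       zero          = 0
sternF _       (suc zero)    = 1
sternF zero    (suc (suc n)) = 0   -- unreachable when fuel ≥ argument
sternF (suc k) (suc (suc n)) with odd? n
... | false = sternF k (suc ⌊ n /2⌋)                       -- n+2 = 2(⌊n/2⌋+1)
... | true  = sternF k (suc ⌊ n /2⌋) + sternF k (suc (suc ⌊ n /2⌋))
                                                           -- n+2 = 2(⌊n/2⌋+1)+1

s : ℕ → ℕ
s n = sternF n n

data A₃ : ℕ → Set where
  a0  : A₃ 0
  a5  : A₃ 5
  a7  : A₃ 7
  dbl : ∀ {n} → 0 < n → A₃ n → A₃ (2 * n)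
  p5  : ∀ {n} → 0 < n → A₃ n → A₃ (8 * n + 5)
  m5  : ∀ {n} → 0 < n → A₃ n → A₃ (8 * n ∸ 5)
  p7  : ∀ {n} → 0 < n → A₃ n → A₃ (8 * n + 7)
  m7  : ∀ {n} → 0 < n → A₃ n → A₃ (8 * n ∸ 7)

{-# OPTIONS --safe #-}
module Submission where

-- Modulo 3 the Stern recurrences give s(2m) = s(m) and, for every b,
--   s(8b+1) ≡ s(b+1),  s(8b+3) ≡ 2 s(b+1),  s(8b+5) ≡ 2 s(b),  s(8b+7) ≡ s(b).
-- Since 2 is a unit mod 3, 3 ∣ s(n) is thus equivalent to 3 ∣ s(p) for the parent p of n under
-- the generating rules of A₃ (note 8b+1 = 8(b+1)−7 and 8b+3 = 8(b+1)−5), so both inclusions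
-- follow by induction, the base cases being s(1) = 1 and s(5) = s(7) = 3.

open import Defs
open import Data.Bool using (true; false)
open import Data.Nat using (ℕ; zero; suc; _+_; _*_; _∸_; _≤_; _<_; z≤n; s≤s; z<s; ⌊_/2⌋)
open import Data.Nat.Coprimality using (Coprime; coprime-divisor; gcd≡1⇒coprime)
open import Data.Nat.Divisibility using (_∣_; ∣-refl; _∣0; ∣1⇒≡1; ∣m∣n⇒∣m+n; ∣m+n∣m⇒∣n; m∣m*n; ∣n⇒∣m*n)
open import Data.Nat.Induction using (<-rec)
open import Data.Nat.Properties
open import Data.Nat.Tactic.RingSolver using (solve-∀)
open import Data.Product using (_×_; _,_)
open import Function.Bundles using (_⇔_; mk⇔; module Equivalence)
open import Relation.Binary.PropositionalEquality
open import Relation.Nullary using (contradiction)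

open Equivalence using (to; from)

1+⌊n/2⌋≤1+n : ∀ n → 1 + ⌊ n /2⌋ ≤ 1 + n
1+⌊n/2⌋≤1+n n = s≤s (⌊n/2⌋≤n n)

odd⇒2+⌊n/2⌋≤1+n : ∀ n → odd? n ≡ true → 2 + ⌊ n /2⌋ ≤ 1 + n
odd⇒2+⌊n/2⌋≤1+n (suc n) _ = s≤s (⌊n/2⌋<n n)

sternF-fuel-irrelevant : ∀ {k j} n → n ≤ k → n ≤ j → sternF k n ≡ sternF j n
sternF-fuel-irrelevant zero          _         _         = refl
sternF-fuel-irrelevant (suc zero)    _         _         = refl
sternF-fuel-irrelevant (suc (suc n)) (s≤s n<k) (s≤s n<j) with odd? n in n-odd
... | false = sternF-fuel-irrelevant (1 + ⌊ n /2⌋)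
                (≤-trans (1+⌊n/2⌋≤1+n n) n<k) (≤-trans (1+⌊n/2⌋≤1+n n) n<j)
... | true  = cong₂ _+_
  (sternF-fuel-irrelevant (1 + ⌊ n /2⌋)
     (≤-trans (1+⌊n/2⌋≤1+n n) n<k) (≤-trans (1+⌊n/2⌋≤1+n n) n<j))
  (sternF-fuel-irrelevant (2 + ⌊ n /2⌋)
     (≤-trans (odd⇒2+⌊n/2⌋≤1+n n n-odd) n<k) (≤-trans (odd⇒2+⌊n/2⌋≤1+n n n-odd) n<j))

sternF≡s : ∀ {k n} → n ≤ k → sternF k n ≡ s n
sternF≡s {n = n} n≤k = sternF-fuel-irrelevant n n≤k ≤-refl

odd?[2m]≡false : ∀ m → odd? (2 * m) ≡ false
odd?[2m]≡false zero    = refl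
odd?[2m]≡false (suc m) rewrite *-suc 2 m = odd?[2m]≡false m

odd?[1+2m]≡true : ∀ m → odd? (1 + 2 * m) ≡ true
odd?[1+2m]≡true zero    = refl
odd?[1+2m]≡true (suc m) = trans (cong (λ x → odd? (1 + x)) (*-suc 2 m)) (odd?[1+2m]≡true m)

⌊2m/2⌋≡m : ∀ m → ⌊ 2 * m /2⌋ ≡ m
⌊2m/2⌋≡m zero    = refl
⌊2m/2⌋≡m (suc m) rewrite *-suc 2 m = cong suc (⌊2m/2⌋≡m m)

⌊1+2m/2⌋≡m : ∀ m → ⌊ 1 + 2 * m /2⌋ ≡ m
⌊1+2m/2⌋≡m zero    = refl
⌊1+2m/2⌋≡m (suc m) = trans (cong (λ x → ⌊ 1 + x /2⌋) (*-suc 2 m)) (cong suc (⌊1+2m/2⌋≡m m))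

sternF-even-step : ∀ k m → sternF (suc k) (2 + 2 * m) ≡ sternF k (1 + m)
sternF-even-step k m rewrite odd?[2m]≡false m | ⌊2m/2⌋≡m m = refl

sternF-odd-step : ∀ k m → sternF (suc k) (3 + 2 * m) ≡ sternF k (1 + m) + sternF k (2 + m)
sternF-odd-step k m rewrite odd?[1+2m]≡true m | ⌊1+2m/2⌋≡m m = refl

s[2+2m]≡s[1+m] : ∀ m → s (2 + 2 * m) ≡ s (1 + m)
s[2+2m]≡s[1+m] m = begin
  s (2 + 2 * m)               ≡⟨ sternF-even-step (1 + 2 * m) m ⟩
  sternF (1 + 2 * m) (1 + m)  ≡⟨ sternF≡s (s≤s (m≤n*m m 2)) ⟩
  s (1 + m)                   ∎
  where open ≡-Reasoning

s[2m]≡s[m] : ∀ m → s (2 * m) ≡ s m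
s[2m]≡s[m] zero    = refl
s[2m]≡s[m] (suc m) = trans (cong s (*-suc 2 m)) (s[2+2m]≡s[1+m] m)

s[1+2m]≡s[m]+s[1+m] : ∀ m → s (1 + 2 * m) ≡ s m + s (1 + m)
s[1+2m]≡s[m]+s[1+m] zero    = refl
s[1+2m]≡s[m]+s[1+m] (suc m) = begin
  s (1 + 2 * suc m)
    ≡⟨ cong (λ x → s (1 + x)) (*-suc 2 m) ⟩
  s (3 + 2 * m)
    ≡⟨ sternF-odd-step (2 + 2 * m) m ⟩
  sternF (2 + 2 * m) (1 + m) + sternF (2 + 2 * m) (2 + m)
    ≡⟨ cong₂ _+_ (sternF≡s (m≤n⇒m≤1+n (s≤s m≤2m))) (sternF≡s (s≤s (s≤s m≤2m))) ⟩
  s (1 + m) + s (2 + m)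
    ∎
  where
  open ≡-Reasoning
  m≤2m : m ≤ 2 * m
  m≤2m = m≤n*m m 2

s[4m+1]≡2s[m]+s[1+m] : ∀ m → s (4 * m + 1) ≡ 2 * s m + s (1 + m)
s[4m+1]≡2s[m]+s[1+m] m = begin
  s (4 * m + 1)              ≡⟨ cong s (4m+1≡1+2[2m] m) ⟩
  s (1 + 2 * (2 * m))        ≡⟨ s[1+2m]≡s[m]+s[1+m] (2 * m) ⟩
  s (2 * m) + s (1 + 2 * m)  ≡⟨ cong₂ _+_ (s[2m]≡s[m] m) (s[1+2m]≡s[m]+s[1+m] m) ⟩
  s m + (s m + s (1 + m))    ≡⟨ x+[x+y]≡2x+y (s m) (s (1 + m)) ⟩
  2 * s m + s (1 + m)        ∎
  where
  open ≡-Reasoning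
  4m+1≡1+2[2m] : ∀ m → 4 * m + 1 ≡ 1 + 2 * (2 * m)
  4m+1≡1+2[2m] = solve-∀
  x+[x+y]≡2x+y : ∀ x y → x + (x + y) ≡ 2 * x + y
  x+[x+y]≡2x+y = solve-∀

s[4m+3]≡s[m]+2s[1+m] : ∀ m → s (4 * m + 3) ≡ s m + 2 * s (1 + m)
s[4m+3]≡s[m]+2s[1+m] m = begin
  s (4 * m + 3)                  ≡⟨ cong s (4m+3≡1+2[1+2m] m) ⟩
  s (1 + 2 * (1 + 2 * m))        ≡⟨ s[1+2m]≡s[m]+s[1+m] (1 + 2 * m) ⟩
  s (1 + 2 * m) + s (2 + 2 * m)  ≡⟨ cong₂ _+_ (s[1+2m]≡s[m]+s[1+m] m) (s[2+2m]≡s[1+m] m) ⟩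
  s m + s (1 + m) + s (1 + m)    ≡⟨ x+y+y≡x+2y (s m) (s (1 + m)) ⟩
  s m + 2 * s (1 + m)            ∎
  where
  open ≡-Reasoning
  4m+3≡1+2[1+2m] : ∀ m → 4 * m + 3 ≡ 1 + 2 * (1 + 2 * m)
  4m+3≡1+2[1+2m] = solve-∀
  x+y+y≡x+2y : ∀ x y → x + y + y ≡ x + 2 * y
  x+y+y≡x+2y = solve-∀

8b+r≡4[2b]+r : ∀ b r → 8 * b + r ≡ 4 * (2 * b) + r
8b+r≡4[2b]+r b r = cong (_+ r) (*-assoc 4 2 b)

8b+4+r≡4[1+2b]+r : ∀ b r → 8 * b + (4 + r) ≡ 4 * (1 + 2 * b) + r
8b+4+r≡4[1+2b]+r = solve-∀

s[8b+1]≡3s[b]+s[1+b] : ∀ b → s (8 * b + 1) ≡ 3 * s b + s (1 + b)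
s[8b+1]≡3s[b]+s[1+b] b = begin
  s (8 * b + 1)                  ≡⟨ cong s (8b+r≡4[2b]+r b 1) ⟩
  s (4 * (2 * b) + 1)            ≡⟨ s[4m+1]≡2s[m]+s[1+m] (2 * b) ⟩
  2 * s (2 * b) + s (1 + 2 * b)  ≡⟨ cong₂ (λ x y → 2 * x + y) (s[2m]≡s[m] b) (s[1+2m]≡s[m]+s[1+m] b) ⟩
  2 * s b + (s b + s (1 + b))    ≡⟨ 2x+[x+y]≡3x+y (s b) (s (1 + b)) ⟩
  3 * s b + s (1 + b)            ∎
  where
  open ≡-Reasoning
  2x+[x+y]≡3x+y : ∀ x y → 2 * x + (x + y) ≡ 3 * x + y
  2x+[x+y]≡3x+y = solve-∀

s[8b+3]≡3s[b]+2s[1+b] : ∀ b → s (8 * b + 3) ≡ 3 * s b + 2 * s (1 + b)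
s[8b+3]≡3s[b]+2s[1+b] b = begin
  s (8 * b + 3)                  ≡⟨ cong s (8b+r≡4[2b]+r b 3) ⟩
  s (4 * (2 * b) + 3)            ≡⟨ s[4m+3]≡s[m]+2s[1+m] (2 * b) ⟩
  s (2 * b) + 2 * s (1 + 2 * b)  ≡⟨ cong₂ (λ x y → x + 2 * y) (s[2m]≡s[m] b) (s[1+2m]≡s[m]+s[1+m] b) ⟩
  s b + 2 * (s b + s (1 + b))    ≡⟨ x+2[x+y]≡3x+2y (s b) (s (1 + b)) ⟩
  3 * s b + 2 * s (1 + b)        ∎
  where
  open ≡-Reasoning
  x+2[x+y]≡3x+2y : ∀ x y → x + 2 * (x + y) ≡ 3 * x + 2 * y
  x+2[x+y]≡3x+2y = solve-∀

s[8b+5]≡3s[1+b]+2s[b] : ∀ b → s (8 * b + 5) ≡ 3 * s (1 + b) + 2 * s b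
s[8b+5]≡3s[1+b]+2s[b] b = begin
  s (8 * b + 5)                      ≡⟨ cong s (8b+4+r≡4[1+2b]+r b 1) ⟩
  s (4 * (1 + 2 * b) + 1)            ≡⟨ s[4m+1]≡2s[m]+s[1+m] (1 + 2 * b) ⟩
  2 * s (1 + 2 * b) + s (2 + 2 * b)  ≡⟨ cong₂ (λ x y → 2 * x + y) (s[1+2m]≡s[m]+s[1+m] b) (s[2+2m]≡s[1+m] b) ⟩
  2 * (s b + s (1 + b)) + s (1 + b)  ≡⟨ 2[x+y]+y≡3y+2x (s b) (s (1 + b)) ⟩
  3 * s (1 + b) + 2 * s b            ∎
  where
  open ≡-Reasoning
  2[x+y]+y≡3y+2x : ∀ x y → 2 * (x + y) + y ≡ 3 * y + 2 * x
  2[x+y]+y≡3y+2x = solve-∀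

s[8b+7]≡3s[1+b]+s[b] : ∀ b → s (8 * b + 7) ≡ 3 * s (1 + b) + s b
s[8b+7]≡3s[1+b]+s[b] b = begin
  s (8 * b + 7)                      ≡⟨ cong s (8b+4+r≡4[1+2b]+r b 3) ⟩
  s (4 * (1 + 2 * b) + 3)            ≡⟨ s[4m+3]≡s[m]+2s[1+m] (1 + 2 * b) ⟩
  s (1 + 2 * b) + 2 * s (2 + 2 * b)  ≡⟨ cong₂ (λ x y → x + 2 * y) (s[1+2m]≡s[m]+s[1+m] b) (s[2+2m]≡s[1+m] b) ⟩
  s b + s (1 + b) + 2 * s (1 + b)    ≡⟨ x+y+2y≡3y+x (s b) (s (1 + b)) ⟩
  3 * s (1 + b) + s b                ∎
  where
  open ≡-Reasoning
  x+y+2y≡3y+x : ∀ x y → x + y + 2 * y ≡ 3 * y + x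
  x+y+2y≡3y+x = solve-∀

∣m*n+o⇔∣o : ∀ m n {o} → m ∣ m * n + o ⇔ m ∣ o
∣m*n+o⇔∣o m n = mk⇔ (λ m∣m*n+o → ∣m+n∣m⇒∣n m∣m*n+o (m∣m*n n)) (∣m∣n⇒∣m+n (m∣m*n n))

coprime⇒∣m*n+k*o⇔∣o : ∀ {m k} n {o} → Coprime m k → m ∣ m * n + k * o ⇔ m ∣ o
coprime⇒∣m*n+k*o⇔∣o {m} {k} n coprime = mk⇔
  (λ m∣m*n+k*o → coprime-divisor coprime (to (∣m*n+o⇔∣o m n) m∣m*n+k*o))
  (λ m∣o → from (∣m*n+o⇔∣o m n) (∣n⇒∣m*n k m∣o))

coprime-3-2 : Coprime 3 2
coprime-3-2 = gcd≡1⇒coprime refl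

3∣s[8b+1]⇔3∣s[1+b] : ∀ b → 3 ∣ s (8 * b + 1) ⇔ 3 ∣ s (1 + b)
3∣s[8b+1]⇔3∣s[1+b] b rewrite s[8b+1]≡3s[b]+s[1+b] b = ∣m*n+o⇔∣o 3 (s b)

3∣s[8b+3]⇔3∣s[1+b] : ∀ b → 3 ∣ s (8 * b + 3) ⇔ 3 ∣ s (1 + b)
3∣s[8b+3]⇔3∣s[1+b] b rewrite s[8b+3]≡3s[b]+2s[1+b] b = coprime⇒∣m*n+k*o⇔∣o (s b) coprime-3-2

3∣s[8b+5]⇔3∣s[b] : ∀ b → 3 ∣ s (8 * b + 5) ⇔ 3 ∣ s b
3∣s[8b+5]⇔3∣s[b] b rewrite s[8b+5]≡3s[1+b]+2s[b] b = coprime⇒∣m*n+k*o⇔∣o (s (1 + b)) coprime-3-2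

3∣s[8b+7]⇔3∣s[b] : ∀ b → 3 ∣ s (8 * b + 7) ⇔ 3 ∣ s b
3∣s[8b+7]⇔3∣s[b] b rewrite s[8b+7]≡3s[1+b]+s[b] b = ∣m*n+o⇔∣o 3 (s (1 + b))

data ParityView : ℕ → Set where
  2*_   : ∀ m → ParityView (2 * m)
  1+2*_ : ∀ m → ParityView (1 + 2 * m)

parityView : ∀ n → ParityView n
parityView zero = 2* 0
parityView (suc n) with parityView n
... | 2* m   = 1+2* m
... | 1+2* m = subst ParityView (*-suc 2 m) (2* suc m)

data Mod8View : ℕ → Set where
  2*_   : ∀ m → Mod8View (2 * m)
  8*_+1 : ∀ b → Mod8View (8 * b + 1)
  8*_+3 : ∀ b → Mod8View (8 * b + 3)
  8*_+5 : ∀ b → Mod8View (8 * b + 5)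
  8*_+7 : ∀ b → Mod8View (8 * b + 7)

8b+[1+2x+4y]≡1+2[x+2[y+2b]] : ∀ b x y → 8 * b + (1 + 2 * x + 4 * y) ≡ 1 + 2 * (x + 2 * (y + 2 * b))
8b+[1+2x+4y]≡1+2[x+2[y+2b]] = solve-∀

mod8View : ∀ n → Mod8View n
mod8View n with parityView n
... | 2* m = 2* m
... | 1+2* m with parityView m
... | 2* a with parityView a
... | 2* b   = subst Mod8View (8b+[1+2x+4y]≡1+2[x+2[y+2b]] b 0 0) (8* b +1)
... | 1+2* b = subst Mod8View (8b+[1+2x+4y]≡1+2[x+2[y+2b]] b 0 1) (8* b +5)
mod8View n | 1+2* m | 1+2* a with parityView a
... | 2* b   = subst Mod8View (8b+[1+2x+4y]≡1+2[x+2[y+2b]] b 1 0) (8* b +3)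
... | 1+2* b = subst Mod8View (8b+[1+2x+4y]≡1+2[x+2[y+2b]] b 1 1) (8* b +7)

8[1+b]∸5≡8b+3 : ∀ b → 8 * (1 + b) ∸ 5 ≡ 8 * b + 3
8[1+b]∸5≡8b+3 b = trans (cong (_∸ 5) (*-suc 8 b)) (+-comm 3 (8 * b))

8[1+b]∸7≡8b+1 : ∀ b → 8 * (1 + b) ∸ 7 ≡ 8 * b + 1
8[1+b]∸7≡8b+1 b = trans (cong (_∸ 7) (*-suc 8 b)) (+-comm 1 (8 * b))

A₃⇒3∣s : ∀ {n} → A₃ n → 3 ∣ s n
A₃⇒3∣s a0               = 3 ∣0
A₃⇒3∣s a5               = ∣-refl
A₃⇒3∣s a7               = ∣-refl
A₃⇒3∣s (dbl {m} _ m∈A₃) = subst (3 ∣_) (sym (s[2m]≡s[m] m)) (A₃⇒3∣s m∈A₃)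
A₃⇒3∣s (p5 {b} _ b∈A₃)  = from (3∣s[8b+5]⇔3∣s[b] b) (A₃⇒3∣s b∈A₃)
A₃⇒3∣s (p7 {b} _ b∈A₃)  = from (3∣s[8b+7]⇔3∣s[b] b) (A₃⇒3∣s b∈A₃)
A₃⇒3∣s (m5 {suc b} _ b∈A₃) rewrite 8[1+b]∸5≡8b+3 b =
  from (3∣s[8b+3]⇔3∣s[1+b] b) (A₃⇒3∣s b∈A₃)
A₃⇒3∣s (m7 {suc b} _ b∈A₃) rewrite 8[1+b]∸7≡8b+1 b =
  from (3∣s[8b+1]⇔3∣s[1+b] b) (A₃⇒3∣s b∈A₃)

3∣s⇒A₃ : ∀ n → 3 ∣ s n → A₃ n
3∣s⇒A₃ = <-rec (λ n → 3 ∣ s n → A₃ n) step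
  where
  b<8b+r : ∀ b {r} → 0 < r → b < 8 * b + r
  b<8b+r b 0<r = ≤-<-trans (m≤n*m b 8) (m<m+n (8 * b) 0<r)
  1+b<8b+3 : ∀ b → 1 + b < 8 * b + 3
  1+b<8b+3 b = subst (1 + b <_) (+-comm 3 (8 * b)) (+-mono-<-≤ {1} {3} (s≤s (s≤s z≤n)) (m≤n*m b 8))
  2+b<8[1+b]+1 : ∀ b → 2 + b < 8 * (1 + b) + 1
  2+b<8[1+b]+1 b = ≤-<-trans (s≤s (m<m+n b z<s)) (m<m+n (8 * (1 + b)) z<s)
  step : ∀ n → (∀ {m} → m < n → 3 ∣ s m → A₃ m) → 3 ∣ s n → A₃ n
  step n ih 3∣sn with mod8View n
  ... | 2* zero      = a0
  ... | 2* suc m     = dbl z<s (ih (m<m+n (suc m) z<s) (subst (3 ∣_) (s[2m]≡s[m] (suc m)) 3∣sn))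
  ... | 8* zero +1   = contradiction (∣1⇒≡1 3∣sn) λ ()
  ... | 8* suc b +1  = subst A₃ (8[1+b]∸7≡8b+1 (suc b))
                         (m7 z<s (ih (2+b<8[1+b]+1 b) (to (3∣s[8b+1]⇔3∣s[1+b] (suc b)) 3∣sn)))
  ... | 8* b +3      = subst A₃ (8[1+b]∸5≡8b+3 b)
                         (m5 z<s (ih (1+b<8b+3 b) (to (3∣s[8b+3]⇔3∣s[1+b] b) 3∣sn)))
  ... | 8* zero +5   = a5
  ... | 8* suc b +5  = p5 z<s (ih (b<8b+r (suc b) z<s) (to (3∣s[8b+5]⇔3∣s[b] (suc b)) 3∣sn))
  ... | 8* zero +7   = a7
  ... | 8* suc b +7  = p7 z<s (ih (b<8b+r (suc b) z<s) (to (3∣s[8b+7]⇔3∣s[b] (suc b)) 3∣sn))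

theorem5p1 : (n : ℕ) → ((3 ∣ s n) → A₃ n) × (A₃ n → 3 ∣ s n)
theorem5p1 n = 3∣s⇒A₃ n , A₃⇒3∣s
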